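{- There exist bounding sequences $(n_k^-)_{k\in\omega},(n_k^+)_{k\in\omega}$ and a modified suitable family $\mathcal{F}=\{(a_\alpha,d_\alpha,b_\alpha,g_\alpha,c_\alpha,h_\alpha,e_\alpha,u_\alpha):\alpha\in A\}$ with respect to them with $|A|=2^{\aleph_0}$.
   Context: For $c,h\in\omega^\omega$: $c^{\triangledown h}(n)=|[c(n)]^{\le h(n)}|$ (number of subsets of $\{0,\dots,c(n)-1\}$ of size $\le h(n)$). $g_{c,h}(k)=\lfloor\log_2c(n)\rfloor$ for $k\in J_n$, where $(J_n)$ is the partition of $\omega$ into consecutive intervals with $|J_n|=h(n)$. $f_{b,g}(k)=\sum_{l\le n}\lceil\log_2b(l)\rceil$ for $k\in I_n$, where $(I_n)$ is the partition into consecutive intervals with $|I_n|=g(n)$. For increasing $f\in\omega^\omega$, $e_f(k)=\min\{n:k<f(2^n)\}$. Bounding sequences: sequences $(n_k^-),(n_k^+)$ of naturals $\ge2$ with $n_k^-\cdot n_k^+<n_{k+1}^-$ for all $k$ and $\lim_k\log_{n_k^- }n_k^+=\infty$. A family $\mathcal{F}$ of tuples of increasing functions in $\omega^\omega$ indexed by $A$ is modified suitable w.r.t. them if for all $\alpha\in A$: (S1) for all $k$, each of $a_\alpha(k),d_\alpha(k),b_\alpha(k),g_\alpha(k),b_\alpha^{\triangledown g_\alpha}(k),b_\alpha(k)/g_\alpha(k),h_\alpha(k),c_\alpha^{\triangledown h_\alpha}(k)$ lies in $[n_k^-,n_k^+]$; (S2) $h_\alpha<c_\alpha$ and $\limsup_k\frac{1}{d_\alpha(k)}\log_{d_\alpha(k)}(h_\alpha(k)+1)=\infty$;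 (S3) $b_\alpha/g_\alpha\ge d_\alpha$; (S4) $a_\alpha\ge b_\alpha^{\triangledown g_\alpha}$; (S7) for all $\beta\in A$, $\beta\ne\alpha$, $\lim_k\min\{c_\beta^{\triangledown h_\beta}(k)/d_\alpha(k),\ a_\alpha(k)/d_\beta(k)\}=0$; (MS1) $e_\alpha=e_{u_\alpha}$; (MS2) $e_\alpha(g_{c_\alpha,h_\alpha}(k))\ge2\log_2k$ for all $k$; (MS3) $f_{b_\alpha,g_\alpha}\le u_\alpha$. -}

module Defs where

open import Data.Nat using (ℕ; zero; suc; _+_; _*_; _∸_; _^_; _≤_; _<_; _≥_; _<?_; _≤?_)
open import Data.Nat.Logarithm using (⌊log₂_⌋; ⌈log₂_⌉)
open import Data.Bool using (Bool; if_then_else_)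
open import Data.List using (List; []; _∷_; _++_; map; length; filter)
open import Data.Vec using (Vec; []; _∷_)
open import Data.Fin.Subset using (Subset; inside; outside; ∣_∣)
open import Data.Product using (Σ; _×_; _,_; ∃)
open import Data.Sum using (_⊎_)
open import Relation.Nullary using (¬_; does)
open import Relation.Binary.PropositionalEquality using (_≡_; _≢_)

allSubsets : (n : ℕ) → List (Subset n)
allSubsets zero = [] ∷ []
allSubsets (suc n) = map (inside ∷_) (allSubsets n) ++ map (outside ∷_) (allSubsets n)

_▽_ : (ℕ → ℕ) → (ℕ → ℕ) → ℕ → ℕ
(c ▽ h) n = length (filter (λ p → ∣ p ∣ ≤? h n) (allSubsets (c n)))

-- Index n of the block I_n containing k, for the partition of ω into
-- consecutive intervals I_0, I_1, … with |I_n| = s n.  (Correct whenever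
-- all s n ≥ 1, which is the case for all uses below; fuel k+1 suffices.)
blockGo : (s : ℕ → ℕ) → ℕ → ℕ → ℕ → ℕ
blockGo s zero n r = n
blockGo s (suc fuel) n r = if does (r <? s n) then n else blockGo s fuel (suc n) (r ∸ s n)

block : (ℕ → ℕ) → ℕ → ℕ
block s k = blockGo s (suc k) 0 k

gFun : (ℕ → ℕ) → (ℕ → ℕ) → ℕ → ℕ
gFun c h k = ⌊log₂ c (block h k) ⌋

sumUpTo : (ℕ → ℕ) → ℕ → ℕ
sumUpTo f zero = f 0
sumUpTo f (suc n) = sumUpTo f n + f (suc n)

fFun : (ℕ → ℕ) → (ℕ → ℕ) → ℕ → ℕ
fFun b g k = sumUpTo (λ l → ⌈log₂ b l ⌉) (block g k)

IsE : (e f : ℕ → ℕ) → Set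
IsE e f = ∀ k → (k < f (2 ^ e k)) × (∀ m → m < e k → f (2 ^ m) ≤ k)

-- increasing (non-decreasing; e_f is never strictly increasing)
Increasing : (ℕ → ℕ) → Set
Increasing f = ∀ k → f k ≤ f (suc k)

InRange : (ℕ → ℕ) → (ℕ → ℕ) → ℕ → ℕ → Set
InRange nm np k x = (nm k ≤ x) × (x ≤ np k)

-- lim_k log_{n⁻_k} n⁺_k = ∞
BoundingSeqs : (nm np : ℕ → ℕ) → Set
BoundingSeqs nm np =
  (∀ k → 2 ≤ nm k) × (∀ k → 2 ≤ np k) ×
  (∀ k → nm k * np k < nm (suc k)) ×
  (∀ M → ∃ λ K → ∀ k → K ≤ k → nm k ^ M ≤ np k)

record Tuple : Set where
  field
    a d b g c h e u : ℕ → ℕ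

-- Cantor space, |A| = 2^ℵ₀
A : Set
A = ℕ → Bool

-- distinctness of indices, as apartness
_#_ : A → A → Set
α # β = ∃ λ n → α n ≢ β n

ModSuitable : (nm np : ℕ → ℕ) → (A → Tuple) → Set
ModSuitable nm np F = ∀ α → let open Tuple (F α) in
  (Increasing a × Increasing d × Increasing b × Increasing g ×
   Increasing c × Increasing h × Increasing e × Increasing u) ×
  -- (S1)   (b/g is real division: n⁻ ≤ b/g ≤ n⁺)
  (∀ k → InRange nm np k (a k) × InRange nm np k (d k) × InRange nm np k (b k) ×
         InRange nm np k (g k) × InRange nm np k ((b ▽ g) k) ×
         (nm k * g k ≤ b k × b k ≤ np k * g k) ×
         InRange nm np k (h k) × InRange nm np k ((c ▽ h) k)) ×
  -- (S2)   limsup (1/d) log_d (h+1) = ∞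
  (∀ k → h k < c k) ×
  (∀ M K → ∃ λ k → K ≤ k × d k ^ (M * d k) ≤ h k + 1) ×
  (∀ k → d k * g k ≤ b k) ×
  (∀ k → (b ▽ g) k ≤ a k) ×
  -- (S7)   lim min{c_β^{▽h_β}/d_α, a_α/d_β} = 0
  (∀ β → β # α → let module B = Tuple (F β) in
     ∀ M → ∃ λ K → ∀ k → K ≤ k →
       (M * (B.c ▽ B.h) k ≤ d k) ⊎ (M * a k ≤ B.d k)) ×
  IsE e u ×
  -- (MS2)  e(g_{c,h}(k)) ≥ 2 log₂ k
  (∀ k → k * k ≤ 2 ^ e (gFun c h k)) ×
  (∀ k → fFun b g k ≤ u k)

module Submission where

-- Each level k of ω carries 2^k slots with bases nm k = D₀ ≤ D₁ ≤ ⋯, D_{i+1} = next D_i = (top D_i)²,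
-- and for base d the values h = d^(d²), g = (2h)², b = d g, a = 2^b, c = 2^(b²), b^{▽g} ≤ 2^b and
-- c^{▽h} ≤ 2^c all lie in [d, top d] with top d = 2^c.  A real α occupies at level k the slot numbered by its first k
-- bits in binary, so distinct reals eventually sit in slots in a fixed order; the lower one's values,
-- even multiplied by M ≤ k, stay below the higher one's base, which is (S7).  (S2) holds as h = d^(d²).
-- For (MS2), the J-block n containing k is longer than all previous ones, so k < 2 h(n) and k² < g(n);
-- hence f_{b,g}(k²) ≤ 2 b(n), while g_{c,h}(k) = b(n)².

open import Defs
open import Data.Bool using (Bool; true; false)
open import Data.Empty using (⊥-elim)
open import Data.Fin.Subset using (Subset; inside; outside; ∣_∣)
open import Data.List using ([]; _∷_; _++_; map; length; filter)
open import Data.List.Properties using (length-++; length-map; filter-++; length-filter; filter-some)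
open import Data.Vec using ([]; _∷_)
open import Data.List.Relation.Unary.Any using (Any; here)
open import Data.List.Relation.Unary.Any.Properties using (++⁺ʳ; map⁺)
open import Data.Nat
open import Data.Nat.GeneralisedArithmetic using (fold)
open import Data.Nat.Logarithm using (⌈log₂_⌉; ⌈log₂⌉-mono-≤; ⌈log₂2^n⌉≡n; ⌊log₂[2^n]⌋≡n)
open import Data.Nat.Properties
open import Data.Product using (Σ; _×_; _,_; proj₁; proj₂; ∃)
open import Data.Sum using (_⊎_; inj₁; inj₂)
open import Relation.Binary.PropositionalEquality
open import Relation.Binary.Definitions using (tri<; tri≈; tri>)
open import Relation.Nullary using (Dec; does; yes; no)
open import Relation.Nullary.Reflects using (ofʸ; ofⁿ)
open import Relation.Unary using (Pred; Decidable)

n<2^n : ∀ n → n < 2 ^ n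
n<2^n zero = z<s
n<2^n (suc n) = begin-strict
  suc n           ≤⟨ n<2^n n ⟩
  2 ^ n           ≡⟨ +-identityʳ (2 ^ n) ⟨
  2 ^ n + 0       <⟨ +-monoʳ-< (2 ^ n) (m^n>0 2 n) ⟩
  2 ^ n + 2 ^ n   ≡⟨ cong (2 ^ n +_) (+-identityʳ (2 ^ n)) ⟨
  2 ^ suc n       ∎
  where open ≤-Reasoning

⌈log₂n⌉≤n : ∀ n → ⌈log₂ n ⌉ ≤ n
⌈log₂n⌉≤n n = ≤-trans (⌈log₂⌉-mono-≤ (<⇒≤ (n<2^n n))) (≤-reflexive (⌈log₂2^n⌉≡n n))

m≤m^n : ∀ m n .{{_ : NonZero n}} → m ≤ m ^ n
m≤m^n zero n = z≤n
m≤m^n (suc m) (suc n) = m≤m*n (suc m) (suc m ^ n) {{m^n≢0 (suc m) n}}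

m≤m*m : ∀ m → m ≤ m * m
m≤m*m zero = z≤n
m≤m*m (suc m) = m≤m*n (suc m) (suc m)

m+m≡2*m : ∀ m → m + m ≡ 2 * m
m+m≡2*m m = cong (m +_) (sym (+-identityʳ m))

subsetCount : ℕ → ℕ → ℕ
subsetCount n h = length (filter (λ p → ∣ p ∣ ≤? h) (allSubsets n))

length-allSubsets : ∀ n → length (allSubsets n) ≡ 2 ^ n
length-allSubsets zero = refl
length-allSubsets (suc n) = begin
  length (map (inside ∷_) xs ++ map (outside ∷_) xs)
    ≡⟨ length-++ (map (inside ∷_) xs) ⟩
  length (map (inside ∷_) xs) + length (map (outside ∷_) xs)
    ≡⟨ cong₂ _+_ (length-map (inside ∷_) xs) (length-map (outside ∷_) xs) ⟩
  length xs + length xs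
    ≡⟨ cong₂ _+_ (length-allSubsets n) (trans (length-allSubsets n) (sym (+-identityʳ (2 ^ n)))) ⟩
  2 ^ suc n ∎
  where
  open ≡-Reasoning
  xs = allSubsets n

subsetCount≤2^n : ∀ n h → subsetCount n h ≤ 2 ^ n
subsetCount≤2^n n h = ≤-trans (length-filter (λ p → ∣ p ∣ ≤? h) (allSubsets n)) (≤-reflexive (length-allSubsets n))

anySmall-allSubsets : ∀ n h → Any (λ p → ∣ p ∣ ≤ h) (allSubsets n)
anySmall-allSubsets zero h = here z≤n
anySmall-allSubsets (suc n) h = ++⁺ʳ (map (inside ∷_) (allSubsets n)) (map⁺ (anySmall-allSubsets n h))

0<subsetCount : ∀ n h → 0 < subsetCount n h
0<subsetCount n h = filter-some (λ p → ∣ p ∣ ≤? h) (anySmall-allSubsets n h)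

length-filter-map : ∀ {a b p q} {A : Set a} {B : Set b} {P : Pred B p} {Q : Pred A q}
  (P? : Decidable P) (Q? : Decidable Q) (f : A → B) →
  (∀ x → does (P? (f x)) ≡ does (Q? x)) →
  ∀ xs → length (filter P? (map f xs)) ≡ length (filter Q? xs)
length-filter-map P? Q? f agree [] = refl
length-filter-map P? Q? f agree (x ∷ xs)
  with does (P? (f x)) | does (Q? x) | agree x
... | true  | .true  | refl = cong suc (length-filter-map P? Q? f agree xs)
... | false | .false | refl = length-filter-map P? Q? f agree xs

does-s≤?s : ∀ m n → does (suc m ≤? suc n) ≡ does (m ≤? n)
does-s≤?s zero n = refl
does-s≤?s (suc m) n = refl

subsetCount-suc : ∀ n h → subsetCount (suc n) (suc h) ≡ subsetCount n h + subsetCount n (suc h)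
subsetCount-suc n h = begin
  length (filter small (map (inside ∷_) xs ++ map (outside ∷_) xs))
    ≡⟨ cong length (filter-++ small (map (inside ∷_) xs) (map (outside ∷_) xs)) ⟩
  length (filter small (map (inside ∷_) xs) ++ filter small (map (outside ∷_) xs))
    ≡⟨ length-++ (filter small (map (inside ∷_) xs)) ⟩
  length (filter small (map (inside ∷_) xs)) + length (filter small (map (outside ∷_) xs))
    ≡⟨ cong₂ _+_ (length-filter-map small (λ p → ∣ p ∣ ≤? h) (inside ∷_) (λ p → does-s≤?s ∣ p ∣ h) xs)
                 (length-filter-map small small (outside ∷_) (λ _ → refl) xs) ⟩
  subsetCount n h + subsetCount n (suc h) ∎
  where
  open ≡-Reasoning
  xs = allSubsets n
  small : ∀ {m} (p : Subset m) → Dec (∣ p ∣ ≤ suc h)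
  small p = ∣ p ∣ ≤? suc h

n<subsetCount : ∀ n {h} → 1 ≤ h → n < subsetCount n h
n<subsetCount zero {h} _ = 0<subsetCount 0 h
n<subsetCount (suc n) {suc h} _ = begin-strict
  suc n                                   <⟨ +-mono-≤ (0<subsetCount n h) (n<subsetCount n (s≤s z≤n)) ⟩
  subsetCount n h + subsetCount n (suc h) ≡⟨ subsetCount-suc n h ⟨
  subsetCount (suc n) (suc h)             ∎
  where open ≤-Reasoning

blockStart : (ℕ → ℕ) → ℕ → ℕ
blockStart s zero = 0
blockStart s (suc n) = blockStart s n + s n

blockStart-mono : ∀ s {m n} → m ≤ n → blockStart s m ≤ blockStart s n
blockStart-mono s {n = zero} z≤n = ≤-refl
blockStart-mono s {m} {suc n} m≤1+n with m≤n⇒m<n∨m≡n m≤1+n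
... | inj₂ refl = ≤-refl
... | inj₁ (s≤s m≤n) = ≤-trans (blockStart-mono s m≤n) (m≤m+n _ _)

blockStart-monoˡ : ∀ {s t} → (∀ l → s l ≤ t l) → ∀ n → blockStart s n ≤ blockStart t n
blockStart-monoˡ s≤t zero = z≤n
blockStart-monoˡ s≤t (suc n) = +-mono-≤ (blockStart-monoˡ s≤t n) (s≤t n)

sumUpTo≡blockStart : ∀ f n → sumUpTo f n ≡ blockStart f (suc n)
sumUpTo≡blockStart f zero = refl
sumUpTo≡blockStart f (suc n) = cong (_+ f (suc n)) (sumUpTo≡blockStart f n)

blockGo-start≤ : ∀ s fuel n r → blockStart s (blockGo s fuel n r) ≤ blockStart s n + r
blockGo-start≤ s zero n r = m≤m+n _ _
blockGo-start≤ s (suc fuel) n r with r <ᵇ s n | <ᵇ-reflects-< r (s n)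
... | true  | _ = m≤m+n _ _
... | false | ofⁿ r≮sn = begin
  blockStart s (blockGo s fuel (suc n) (r ∸ s n)) ≤⟨ blockGo-start≤ s fuel (suc n) (r ∸ s n) ⟩
  blockStart s n + s n + (r ∸ s n)                ≡⟨ +-assoc (blockStart s n) (s n) (r ∸ s n) ⟩
  blockStart s n + (s n + (r ∸ s n))              ≡⟨ cong (blockStart s n +_) (m+[n∸m]≡n (≮⇒≥ r≮sn)) ⟩
  blockStart s n + r                              ∎
  where open ≤-Reasoning

<blockGo-end : ∀ s → (∀ l → 1 ≤ s l) → ∀ fuel n r → r < fuel →
  blockStart s n + r < blockStart s (suc (blockGo s fuel n r))
<blockGo-end s s≥1 (suc fuel) n r r<fuel with r <ᵇ s n | <ᵇ-reflects-< r (s n)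
... | true  | ofʸ r<sn = +-monoʳ-< (blockStart s n) r<sn
... | false | ofⁿ r≮sn = begin-strict
  blockStart s n + r                                    ≡⟨ cong (blockStart s n +_) (m+[n∸m]≡n (≮⇒≥ r≮sn)) ⟨
  blockStart s n + (s n + (r ∸ s n))                    ≡⟨ +-assoc (blockStart s n) (s n) (r ∸ s n) ⟨
  blockStart s (suc n) + (r ∸ s n)                      <⟨ <blockGo-end s s≥1 fuel (suc n) (r ∸ s n) r∸sn<fuel ⟩
  blockStart s (suc (blockGo s fuel (suc n) (r ∸ s n))) ∎
  where
  open ≤-Reasoning
  ∸<pred : ∀ {r t fuel} → 1 ≤ t → t ≤ r → r < suc fuel → r ∸ t < fuel
  ∸<pred {suc r} {suc t} _ _ (s≤s r<fuel) = ≤-<-trans (m∸n≤m r t) r<fuel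
  r∸sn<fuel : r ∸ s n < fuel
  r∸sn<fuel = ∸<pred (s≥1 n) (≮⇒≥ r≮sn) r<fuel

blockStart-block≤ : ∀ s k → blockStart s (block s k) ≤ k
blockStart-block≤ s k = blockGo-start≤ s (suc k) 0 k

<blockStart-block : ∀ s → (∀ l → 1 ≤ s l) → ∀ k → k < blockStart s (suc (block s k))
<blockStart-block s s≥1 k = <blockGo-end s s≥1 (suc k) 0 k ≤-refl

block≤ : ∀ s {k m} → k < blockStart s (suc m) → block s k ≤ m
block≤ s {k} {m} k<end with block s k ≤? m
... | yes le = le
... | no m<block = ⊥-elim (<⇒≱ k<end (begin
  blockStart s (suc m)     ≤⟨ blockStart-mono s (≰⇒> m<block) ⟩
  blockStart s (block s k) ≤⟨ blockStart-block≤ s k ⟩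
  k                        ∎))
  where open ≤-Reasoning

block-mono : ∀ s → (∀ l → 1 ≤ s l) → ∀ {k k′} → k ≤ k′ → block s k ≤ block s k′
block-mono s s≥1 k≤k′ = block≤ s (≤-<-trans k≤k′ (<blockStart-block s s≥1 _))

fFun≡blockStart : ∀ b g k → fFun b g k ≡ blockStart (λ l → ⌈log₂ b l ⌉) (suc (block g k))
fFun≡blockStart b g k = sumUpTo≡blockStart (λ l → ⌈log₂ b l ⌉) (block g k)

fFun-mono : ∀ b g → (∀ l → 1 ≤ g l) → ∀ {k k′} → k ≤ k′ → fFun b g k ≤ fFun b g k′
fFun-mono b g g≥1 {k} {k′} k≤k′ = subst₂ _≤_ (sym (fFun≡blockStart b g k)) (sym (fFun≡blockStart b g k′))
  (blockStart-mono _ (s≤s (block-mono g g≥1 k≤k′)))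

searchExp : (ℕ → ℕ) → ℕ → ℕ → ℕ → ℕ
searchExp u k zero n = n
searchExp u k (suc fuel) n with k <ᵇ u (2 ^ n)
... | true = n
... | false = searchExp u k fuel (suc n)

-- Fuel k suffices when u is inflationary: k < 2 ^ k ≤ u (2 ^ k).
leastExp : (ℕ → ℕ) → ℕ → ℕ
leastExp u k = searchExp u k k 0

searchExp-isLeast : ∀ u k fuel n → (∀ m → m < n → u (2 ^ m) ≤ k) → k < u (2 ^ (n + fuel)) →
  (k < u (2 ^ searchExp u k fuel n)) × (∀ m → m < searchExp u k fuel n → u (2 ^ m) ≤ k)
searchExp-isLeast u k zero n below k<u = subst (λ z → k < u (2 ^ z)) (+-identityʳ n) k<u , below
searchExp-isLeast u k (suc fuel) n below k<u with k <ᵇ u (2 ^ n) | <ᵇ-reflects-< k (u (2 ^ n))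
... | true  | ofʸ k<un = k<un , below
... | false | ofⁿ k≮un = searchExp-isLeast u k fuel (suc n) below′ (subst (λ z → k < u (2 ^ z)) (+-suc n fuel) k<u)
  where
  below′ : ∀ m → m < suc n → u (2 ^ m) ≤ k
  below′ m m<1+n with m<1+n⇒m<n∨m≡n m<1+n
  ... | inj₁ m<n = below m m<n
  ... | inj₂ refl = ≮⇒≥ k≮un

leastExp-isE : ∀ u → (∀ x → x ≤ u x) → IsE (leastExp u) u
leastExp-isE u u-infl k = searchExp-isLeast u k k 0 (λ _ ()) (<-≤-trans (n<2^n k) (u-infl (2 ^ k)))

IsE⇒Increasing : ∀ {e u} → IsE e u → Increasing e
IsE⇒Increasing {e} isE k with e (suc k) <? e k
... | no e[k+1]≮e[k] = ≮⇒≥ e[k+1]≮e[k]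
... | yes e[k+1]<e[k] = ⊥-elim (<⇒≱ (proj₁ (isE (suc k))) (m≤n⇒m≤1+n (proj₂ (isE k) (e (suc k)) e[k+1]<e[k])))

IsE⇒≤2^e : ∀ {e u} → IsE e u → (∀ {x y} → x ≤ y → u x ≤ u y) → ∀ {x y} → u x ≤ y → x ≤ 2 ^ e y
IsE⇒≤2^e {e} {u} isE u-mono {x} {y} ux≤y with x ≤? 2 ^ e y
... | yes x≤2^e = x≤2^e
... | no x≰2^e = ⊥-elim (<⇒≱ (proj₁ (isE y)) (≤-trans (u-mono (<⇒≤ (≰⇒> x≰2^e))) ux≤y))

hOf gOf bOf aOf cOf top next : ℕ → ℕ
hOf D = D ^ (D * D)
gOf D = (2 * hOf D) * (2 * hOf D)
bOf D = D * gOf D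
aOf D = 2 ^ bOf D
cOf D = 2 ^ (bOf D * bOf D)
top D = 2 ^ cOf D
next D = top D * top D

InSlot : ℕ → ℕ → Set
InSlot D x = D ≤ x × x ≤ top D

module _ {D : ℕ} (D≥1 : 1 ≤ D) where

  instance
    _ : NonZero D
    _ = >-nonZero D≥1

  D≤h : D ≤ hOf D
  D≤h = m≤m^n D (D * D) {{m*n≢0 D D}}

  1≤h : 1 ≤ hOf D
  1≤h = ≤-trans D≥1 D≤h

  h≤g : hOf D ≤ gOf D
  h≤g = ≤-trans (m≤m+n (hOf D) (hOf D + 0)) (m≤m*m (2 * hOf D))

  g≤b : gOf D ≤ bOf D
  g≤b = m≤n*m (gOf D) D

  b<a : bOf D < aOf D
  b<a = n<2^n (bOf D)

  a≤c : aOf D ≤ cOf D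
  a≤c = ^-monoʳ-≤ 2 (m≤m*m (bOf D))

  c<top : cOf D < top D
  c<top = n<2^n (cOf D)

  private
    b≤c : bOf D ≤ cOf D
    b≤c = ≤-trans (<⇒≤ b<a) a≤c

    b≤top : bOf D ≤ top D
    b≤top = ≤-trans b≤c (<⇒≤ c<top)

    D≤b : D ≤ bOf D
    D≤b = ≤-trans D≤h (≤-trans h≤g g≤b)

  slot-h : InSlot D (hOf D)
  slot-h = D≤h , ≤-trans (≤-trans h≤g g≤b) b≤top

  slot-g : InSlot D (gOf D)
  slot-g = ≤-trans D≤h h≤g , ≤-trans g≤b b≤top

  slot-b : InSlot D (bOf D)
  slot-b = D≤b , b≤top

  slot-a : InSlot D (aOf D)
  slot-a = ≤-trans D≤b (<⇒≤ b<a) , ≤-trans a≤c (<⇒≤ c<top)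

  slot-c : InSlot D (cOf D)
  slot-c = ≤-trans D≤b b≤c , <⇒≤ c<top

  slot-d : InSlot D D
  slot-d = ≤-refl , ≤-trans D≤b b≤top

  slot-subsetCount-bg : InSlot D (subsetCount (bOf D) (gOf D))
  slot-subsetCount-bg = ≤-trans D≤b (<⇒≤ (n<subsetCount (bOf D) (≤-trans 1≤h h≤g)))
                      , ≤-trans (subsetCount≤2^n (bOf D) (gOf D)) (proj₂ slot-a)

  slot-subsetCount-ch : InSlot D (subsetCount (cOf D) (hOf D))
  slot-subsetCount-ch = ≤-trans (proj₁ slot-c) (<⇒≤ (n<subsetCount (cOf D) 1≤h))
                      , subsetCount≤2^n (cOf D) (hOf D)

  D<top : D < top D
  D<top = ≤-<-trans (proj₁ slot-c) c<top

  h<c : hOf D < cOf D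
  h<c = ≤-<-trans (≤-trans (≤-trans h≤g g≤b) (m≤m*m (bOf D))) (n<2^n (bOf D * bOf D))

  3≤b : 3 ≤ bOf D
  3≤b = ≤-trans (n≤1+n 3) (≤-trans (*-mono-≤ (*-monoʳ-≤ 2 1≤h) (*-monoʳ-≤ 2 1≤h)) g≤b)

top-mono : ∀ {D E} → 1 ≤ D → D ≤ E → top D ≤ top E
top-mono {D} {E} D≥1 D≤E = ^-monoʳ-≤ 2 (^-monoʳ-≤ 2 (*-mono-≤ b-mono b-mono))
  where
  instance
    _ : NonZero D
    _ = >-nonZero D≥1
  h-mono : hOf D ≤ hOf E
  h-mono = ≤-trans (^-monoˡ-≤ (D * D) D≤E) (^-monoʳ-≤ E {{>-nonZero (≤-trans D≥1 D≤E)}} (*-mono-≤ D≤E D≤E))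
  2h-mono : 2 * hOf D ≤ 2 * hOf E
  2h-mono = *-monoʳ-≤ 2 h-mono
  b-mono : bOf D ≤ bOf E
  b-mono = *-mono-≤ D≤E (*-mono-≤ 2h-mono 2h-mono)

D≤top : ∀ D → D ≤ top D
D≤top zero = z≤n
D≤top (suc D) = <⇒≤ (D<top (s≤s z≤n))

top≤next : ∀ D → top D ≤ next D
top≤next D = m≤m*n (top D) (top D) {{>-nonZero (m^n>0 2 (cOf D))}}

D≤next : ∀ D → D ≤ next D
D≤next D = ≤-trans (D≤top D) (top≤next D)

fold-inflationary : ∀ {f : ℕ → ℕ} → (∀ x → x ≤ f x) → ∀ x n → x ≤ fold x f n
fold-inflationary f-infl x zero = ≤-refl
fold-inflationary f-infl x (suc n) = ≤-trans (fold-inflationary f-infl x n) (f-infl _)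

fold-mono : ∀ {f : ℕ → ℕ} → (∀ x → x ≤ f x) → ∀ x {m n} → m ≤ n → fold x f m ≤ fold x f n
fold-mono f-infl x {zero} {n} _ = fold-inflationary f-infl x n
fold-mono f-infl x {suc m} {suc n} (s≤s m≤n) with m≤n⇒m<n∨m≡n m≤n
... | inj₂ refl = ≤-refl
... | inj₁ m<n = ≤-trans (fold-mono f-infl x m<n) (f-infl _)

nm : ℕ → ℕ
nm zero = 2
nm (suc k) = fold (nm k) next (suc (2 ^ k))

slotBase : ℕ → ℕ → ℕ
slotBase k i = fold (nm k) next i

np : ℕ → ℕ
np k = top (slotBase k (2 ^ k))

nm≤slotBase : ∀ k i → nm k ≤ slotBase k i
nm≤slotBase k = fold-inflationary D≤next (nm k)

slotBase-mono : ∀ k {i j} → i ≤ j → slotBase k i ≤ slotBase k j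
slotBase-mono k = fold-mono D≤next (nm k)

2≤nm : ∀ k → 2 ≤ nm k
2≤nm zero = ≤-refl
2≤nm (suc k) = ≤-trans (2≤nm k) (nm≤slotBase k (suc (2 ^ k)))

1≤slotBase : ∀ k i → 1 ≤ slotBase k i
1≤slotBase k i = ≤-trans (≤-trans (n≤1+n 1) (2≤nm k)) (nm≤slotBase k i)

nm<np : ∀ k → nm k < np k
nm<np k = ≤-<-trans (nm≤slotBase k (2 ^ k)) (D<top (1≤slotBase k (2 ^ k)))

2≤np : ∀ k → 2 ≤ np k
2≤np k = ≤-trans (2≤nm k) (<⇒≤ (nm<np k))

np≤nm-suc : ∀ k → np k ≤ nm (suc k)
np≤nm-suc k = top≤next (slotBase k (2 ^ k))

k<nm : ∀ k → k < nm k
k<nm zero = z<s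
k<nm (suc k) = ≤-<-trans (k<nm k) (<-≤-trans (nm<np k) (np≤nm-suc k))

nm^M≤np : ∀ k {M} → M ≤ k → nm k ^ M ≤ np k
nm^M≤np k {M} M≤k = begin
  nm k ^ M              ≤⟨ ^-monoʳ-≤ (nm k) {{>-nonZero 1≤nm}} (≤-trans (≤-trans M≤k (<⇒≤ (k<nm k))) (m≤m*m (nm k))) ⟩
  hOf (nm k)            ≤⟨ proj₂ (slot-h 1≤nm) ⟩
  top (nm k)            ≤⟨ top-mono 1≤nm (nm≤slotBase k (2 ^ k)) ⟩
  np k                  ∎
  where
  open ≤-Reasoning
  1≤nm = ≤-trans (n≤1+n 1) (2≤nm k)

bounding : BoundingSeqs nm np
bounding = 2≤nm , 2≤np , (λ k → *-monoˡ-< (np k) {{>-nonZero (≤-trans (n≤1+n 1) (2≤np k))}} (nm<np k))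
         , λ M → M , λ k → nm^M≤np k

bit : Bool → ℕ
bit false = 0
bit true = 1

bit≤1 : ∀ x → bit x ≤ 1
bit≤1 false = z≤n
bit≤1 true = ≤-refl

code : A → ℕ → ℕ
code α zero = 0
code α (suc k) = 2 * code α k + bit (α k)

2m+1<2[1+m] : ∀ m → 2 * m + 1 < 2 * suc m
2m+1<2[1+m] m = begin-strict
  2 * m + 1     <⟨ +-monoʳ-< (2 * m) (n<1+n 1) ⟩
  2 * m + 2     ≡⟨ *-distribˡ-+ 2 m 1 ⟨
  2 * (m + 1)   ≡⟨ cong (2 *_) (+-comm m 1) ⟩
  2 * suc m     ∎
  where open ≤-Reasoning

2m+x<2n+y : ∀ {m n} x y → m < n → x ≤ 1 → 2 * m + x < 2 * n + y
2m+x<2n+y {m} {n} x y m<n x≤1 = begin-strict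
  2 * m + x     ≤⟨ +-monoʳ-≤ (2 * m) x≤1 ⟩
  2 * m + 1     <⟨ 2m+1<2[1+m] m ⟩
  2 * suc m     ≤⟨ *-monoʳ-≤ 2 m<n ⟩
  2 * n         ≤⟨ m≤m+n (2 * n) y ⟩
  2 * n + y     ∎
  where open ≤-Reasoning

code<2^k : ∀ α k → code α k < 2 ^ k
code<2^k α zero = z<s
code<2^k α (suc k) = ≤-trans (2m+x<2n+y (bit (α k)) 0 (code<2^k α k) (bit≤1 (α k)))
                             (≤-reflexive (+-identityʳ (2 * 2 ^ k)))

CodeEventuallyBelow : A → A → Set
CodeEventuallyBelow α β = ∃ λ K → ∀ k → K ≤ k → code α k < code β k

code-<-stable : ∀ α β {K k} → K ≤ k → code α K < code β K → code α k < code β k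
code-<-stable α β {K} {zero} z≤n below = below
code-<-stable α β {K} {suc k} K≤1+k below with m≤n⇒m<n∨m≡n K≤1+k
... | inj₂ refl = below
... | inj₁ (s≤s K≤k) = 2m+x<2n+y (bit (α k)) (bit (β k)) (code-<-stable α β K≤k below) (bit≤1 (α k))

code-suc-split : ∀ α β n → α n ≢ β n → code α (suc n) < code β (suc n) ⊎ code β (suc n) < code α (suc n)
code-suc-split α β n αn≢βn with <-cmp (code α n) (code β n) | α n | β n
... | tri< lt _ _ | x | y = inj₁ (2m+x<2n+y (bit x) (bit y) lt (bit≤1 x))
... | tri> _ _ gt | x | y = inj₂ (2m+x<2n+y (bit y) (bit x) gt (bit≤1 y))
... | tri≈ _ eq _ | false | true  = inj₁ (subst (λ c → 2 * code α n + 0 < 2 * c + 1) eq (+-monoʳ-< _ z<s))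
... | tri≈ _ eq _ | true  | false = inj₂ (subst (λ c → 2 * c + 0 < 2 * code α n + 1) eq (+-monoʳ-< _ z<s))
... | tri≈ _ _ _ | false | false = ⊥-elim (αn≢βn refl)
... | tri≈ _ _ _ | true  | true  = ⊥-elim (αn≢βn refl)

apart⇒code-separates : ∀ {α β} → α # β → CodeEventuallyBelow α β ⊎ CodeEventuallyBelow β α
apart⇒code-separates {α} {β} (n , αn≢βn) with code-suc-split α β n αn≢βn
... | inj₁ below = inj₁ (suc n , λ k n<k → code-<-stable α β n<k below)
... | inj₂ above = inj₂ (suc n , λ k n<k → code-<-stable β α n<k above)

blockStart-suc≤double : ∀ {s} → (∀ l → s l ≤ np l) → ∀ n → nm n ≤ s n → blockStart s (suc n) ≤ 2 * s n
blockStart-suc≤double {s} s≤np n nm≤s =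
  ≤-trans (+-monoˡ-≤ (s n) (≤-trans (blockStart≤nm n) nm≤s)) (≤-reflexive (m+m≡2*m (s n)))
  where
  blockStart≤nm : ∀ n → blockStart s n ≤ nm n
  blockStart≤nm zero = z≤n
  blockStart≤nm (suc n) = begin
    blockStart s n + s n ≤⟨ +-mono-≤ (blockStart≤nm n) (s≤np n) ⟩
    nm n + np n         ≤⟨ +-monoˡ-≤ (np n) (<⇒≤ (nm<np n)) ⟩
    np n + np n         ≡⟨ m+m≡2*m (np n) ⟩
    2 * np n            ≤⟨ *-monoˡ-≤ (np n) (2≤np n) ⟩
    nm (suc n)          ∎
    where open ≤-Reasoning

inRange⇒Increasing : ∀ {lo hi f} → (∀ k → hi k ≤ lo (suc k)) → (∀ k → InRange lo hi k (f k)) → Increasing f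
inRange⇒Increasing hi≤lo r k = ≤-trans (proj₂ (r k)) (≤-trans (hi≤lo k) (proj₁ (r (suc k))))

below-later-slot : ∀ k {i j M x} → i < j → M ≤ top (slotBase k i) → x ≤ top (slotBase k i) →
  M * x ≤ slotBase k j
below-later-slot k i<j M≤top x≤top = ≤-trans (*-mono-≤ M≤top x≤top) (slotBase-mono k i<j)

module Family (α : A) where

  d h g b a c u e : ℕ → ℕ
  d k = slotBase k (code α k)
  h k = hOf (d k)
  g k = gOf (d k)
  b k = bOf (d k)
  a k = aOf (d k)
  c k = cOf (d k)
  -- The summand x makes u inflationary, so that e_u exists.
  u x = x + fFun b g x
  e = leastExp u

  1≤d : ∀ k → 1 ≤ d k
  1≤d k = 1≤slotBase k (code α k)

  nm≤d : ∀ k → nm k ≤ d k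
  nm≤d k = nm≤slotBase k (code α k)

  k≤top-d : ∀ k → k ≤ top (d k)
  k≤top-d k = ≤-trans (<⇒≤ (k<nm k)) (≤-trans (nm≤d k) (D≤top (d k)))

  slot⊆range : ∀ k {x} → InSlot (d k) x → InRange nm np k x
  slot⊆range k (d≤x , x≤top) = ≤-trans (nm≤d k) d≤x
                             , ≤-trans x≤top (top-mono (1≤d k) (slotBase-mono k (<⇒≤ (code<2^k α k))))

  g≥1 : ∀ k → 1 ≤ g k
  g≥1 k = ≤-trans (1≤h (1≤d k)) (h≤g (1≤d k))

  u-mono : ∀ {x y} → x ≤ y → u x ≤ u y
  u-mono x≤y = +-mono-≤ x≤y (fFun-mono b g g≥1 x≤y)

  isE : IsE e u
  isE = leastExp-isE u (λ x → m≤m+n x _)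

  S2 : ∀ M K → ∃ λ k → K ≤ k × d k ^ (M * d k) ≤ h k + 1
  S2 M K = K + M , m≤m+n K M , ≤-trans (^-monoʳ-≤ (d k) {{>-nonZero (1≤d k)}} (*-monoˡ-≤ (d k) M≤d)) (m≤m+n _ 1)
    where
    k = K + M
    M≤d : M ≤ d k
    M≤d = ≤-trans (m≤n+m M K) (≤-trans (<⇒≤ (k<nm k)) (nm≤d k))

  u[k*k]≤gFun : ∀ k → u (k * k) ≤ gFun c h k
  u[k*k]≤gFun k = begin
    k * k + fFun b g (k * k)                            ≤⟨ +-mono-≤ (<⇒≤ k*k<g) f≤2b ⟩
    g n + 2 * b n                                       ≤⟨ +-monoˡ-≤ (2 * b n) (g≤b D≥1) ⟩
    3 * b n                                             ≤⟨ *-monoˡ-≤ (b n) (3≤b D≥1) ⟩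
    b n * b n                                           ≡⟨ ⌊log₂[2^n]⌋≡n (b n * b n) ⟨
    gFun c h k                                          ∎
    where
    open ≤-Reasoning
    n = block h k
    D≥1 = 1≤d n
    bounded : ∀ {s : ℕ → ℕ} → (∀ l → InSlot (d l) (s l)) → ∀ l → s l ≤ np l
    bounded in-slot l = proj₂ (slot⊆range l (in-slot l))
    k<2h : k < 2 * h n
    k<2h = <-≤-trans (<blockStart-block h (λ l → 1≤h (1≤d l)) k)
                     (blockStart-suc≤double (bounded (λ l → slot-h (1≤d l))) n (≤-trans (nm≤d n) (D≤h D≥1)))
    k*k<g : k * k < g n
    k*k<g = *-mono-< k<2h k<2h
    f≤2b : fFun b g (k * k) ≤ 2 * b n
    f≤2b = begin
      fFun b g (k * k)
        ≡⟨ fFun≡blockStart b g (k * k) ⟩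
      blockStart (λ l → ⌈log₂ b l ⌉) (suc (block g (k * k)))
        ≤⟨ blockStart-mono (λ l → ⌈log₂ b l ⌉) (s≤s (block≤ g {m = n} (<-≤-trans k*k<g (m≤n+m (g n) _)))) ⟩
      blockStart (λ l → ⌈log₂ b l ⌉) (suc n)
        ≤⟨ blockStart-monoˡ (λ l → ⌈log₂n⌉≤n (b l)) (suc n) ⟩
      blockStart b (suc n)
        ≤⟨ blockStart-suc≤double (bounded (λ l → slot-b (1≤d l))) n (≤-trans (nm≤d n) (proj₁ (slot-b D≥1))) ⟩
      2 * b n ∎

family : A → Tuple
family α = record { a = a ; d = d ; b = b ; g = g ; c = c ; h = h ; e = e ; u = u }
  where open Family α

S7 : ∀ α β → β # α → ∀ M → ∃ λ K → ∀ k → K ≤ k →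
  (M * subsetCount (Family.c β k) (Family.h β k) ≤ Family.d α k) ⊎ (M * Family.a α k ≤ Family.d β k)
S7 α β β#α M with apart⇒code-separates β#α
... | inj₁ (K , β<α) = K + M , λ k K+M≤k → inj₁ (below-later-slot k (β<α k (m+n≤o⇒m≤o K K+M≤k))
        (≤-trans (m+n≤o⇒n≤o K K+M≤k) (Family.k≤top-d β k)) (proj₂ (slot-subsetCount-ch (Family.1≤d β k))))
... | inj₂ (K , α<β) = K + M , λ k K+M≤k → inj₂ (below-later-slot k (α<β k (m+n≤o⇒m≤o K K+M≤k))
        (≤-trans (m+n≤o⇒n≤o K K+M≤k) (Family.k≤top-d α k)) (proj₂ (slot-a (Family.1≤d α k))))

family-modSuitable : ModSuitable nm np family
family-modSuitable α =
  ( increasing slot-a , increasing slot-d , increasing slot-b , increasing slot-g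
  , increasing slot-c , increasing slot-h , IsE⇒Increasing {u = u} isE , (λ k → u-mono (n≤1+n k)) )
  , (λ k → range slot-a k , range slot-d k , range slot-b k , range slot-g k , range slot-subsetCount-bg k
         , (*-monoˡ-≤ (g k) (proj₁ (range slot-d k)) , *-monoˡ-≤ (g k) (proj₂ (range slot-d k)))
         , range slot-h k , range slot-subsetCount-ch k)
  , (λ k → h<c (1≤d k))
  , S2
  , (λ k → ≤-refl)
  , (λ k → subsetCount≤2^n (b k) (g k))
  , S7 α
  , isE
  , (λ k → IsE⇒≤2^e isE u-mono (u[k*k]≤gFun k))
  , (λ k → m≤n+m (fFun b g k) k)
  where
  open Family α
  range : ∀ {f : ℕ → ℕ} → (∀ {D} → 1 ≤ D → InSlot D (f D)) → ∀ k → InRange nm np k (f (d k))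
  range in-slot k = slot⊆range k (in-slot (1≤d k))
  increasing : ∀ {f : ℕ → ℕ} → (∀ {D} → 1 ≤ D → InSlot D (f D)) → Increasing (λ k → f (d k))
  increasing in-slot = inRange⇒Increasing np≤nm-suc (range in-slot)

mainTheorem15 : Σ (ℕ → ℕ) λ nm → Σ (ℕ → ℕ) λ np →
    BoundingSeqs nm np × Σ (A → Tuple) λ F → ModSuitable nm np F
mainTheorem15 = nm , np , bounding , family , family-modSuitable
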